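{- For every thin groupoid $A$, the identity span $(A,\langle\mathrm{id}_A,\mathrm{id}_A\rangle)$, i.e. $A\xleftarrow{\mathrm{id}_A}A\xrightarrow{\mathrm{id}_A}A$, belongs to $\mathbf{T}_{A\multimap A}$.
   Context: All groupoids are small. Prestrategies. A prestrategy on $A$ is $(S,\partial^S:S\to A)$. Bipullbacks. For a cospan $S\xrightarrow{u}B\xleftarrow{v}T$: - a pseudocone with vertex $X$ is $(l',r',\nu:ul'\Rightarrow vr')$; - morphisms are $(\alpha,\beta)$ with $\nu''\circ u\alpha=v\beta\circ\nu$; - $(P,l,r,\mu)$ is a bipullback if for every $X$, $h\mapsto(lh,rh,\mu h)$ is an equivalence from functors $X\to P$ to pseudocones with vertex $X$; - commuting squares carry identity $2$-cells. Uniform structure. $S\perp T$ iff the pullback of $S\to B\leftarrow T$ is a bipullback, and $\mathbf{S}^\perp=\{T\mid\forall S\in\mathbf{S},S\perp T\}$. A uniform groupoid is $(A,\mathbf{U}_A)$ with $\mathbf{U}_A^{\perp\perp}=\mathbf{U}_A$. Thin structure. For $S\in\mathbf{U}_A$ and $T\in\mathbf{U}_A^\perp$, $S\perp_{\mathrm{th}}T$ iff the pullback of $S\to A\leftarrow T$ is discrete. $\mathbf{S}^{\perp_{\mathrm{th}}}$ is taken within $\mathbf{U}_A^\perp$ for $\mathbf{S}\subseteq\mathbf{U}_A$, and within $\mathbf{U}_A$ for subsets of $\mathbf{U}_A^\perp$. A thin groupoid is a groupoid $A$ with subgroupoids $A_-,A_+$ containing all objects, a uniform structure $\mathbf{U}_A$,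 and $\mathbf{T}_A\subseteq\mathbf{U}_A$ with $\mathbf{T}_A^{\perp_{\mathrm{th}}\perp_{\mathrm{th}}}=\mathbf{T}_A$, $(A_-,\mathrm{incl})\in\mathbf{T}_A$ and $(A_+,\mathrm{incl})\in\mathbf{T}_A^{\perp_{\mathrm{th}}}$. Linear arrow. For thin $A,B$, $A\multimap B$ has: - underlying groupoid $A\times B$; - $(A\multimap B)_-=A_+\times B_-$ and $(A\multimap B)_+=A_-\times B_+$; - $\mathbf{U}_{A\multimap B}=\{(S\times U,\partial^S\times\partial^U)\mid S\in\mathbf{U}_A,U\in\mathbf{U}_B^\perp\}^\perp$; - $\mathbf{T}_{A\multimap B}=\{T\in\mathbf{U}_{A\multimap B}\mid$ the pullback of $T\to A\times B\leftarrow S\times U$ is discrete for all $S\in\mathbf{T}_A$ and $U\in\mathbf{T}_B^{\perp_{\mathrm{th}}}\}$. -}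

{-# OPTIONS --with-K #-}
module Defs where

-- Conventions.
-- * We work with K (UIP), so every Agda type is a set, matching the
--   set-theoretic reading of "small groupoid" in the paper.
-- * A small groupoid has a Set of objects, Sets of morphisms and
--   inverses for all morphisms; equations between morphisms are
--   propositional equalities.

open import Level using (Level) renaming (suc to lsuc)
open import Data.Product using (Σ; Σ-syntax; _×_; _,_; proj₁; proj₂)
open import Relation.Binary.PropositionalEquality
  using (_≡_; refl; sym; trans; cong; cong₂; subst; module ≡-Reasoning)

record Groupoid : Set₁ where
  infixr 9 _∘_
  field
    Obj   : Set
    Hom   : Obj → Obj → Set
    id    : ∀ {x} → Hom x x
    _∘_   : ∀ {x y z} → Hom y z → Hom x y → Hom x z
    inv   : ∀ {x y} → Hom x y → Hom y x
    idl   : ∀ {x y} (f : Hom x y) → id ∘ f ≡ f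
    idr   : ∀ {x y} (f : Hom x y) → f ∘ id ≡ f
    assoc : ∀ {w x y z} (h : Hom y z) (g : Hom x y) (f : Hom w x) →
            (h ∘ g) ∘ f ≡ h ∘ (g ∘ f)
    invl  : ∀ {x y} (f : Hom x y) → inv f ∘ f ≡ id
    invr  : ∀ {x y} (f : Hom x y) → f ∘ inv f ≡ id

module GL (G : Groupoid) where
  open Groupoid G
  open ≡-Reasoning

  square-∘ : ∀ {a b c a' b' c'}
    {A : Hom a a'} {A' : Hom b b'} {A'' : Hom c c'}
    {U : Hom a b} {U' : Hom b c} {V : Hom a' b'} {V' : Hom b' c'} →
    A'' ∘ U' ≡ V' ∘ A' → A' ∘ U ≡ V ∘ A → A'' ∘ (U' ∘ U) ≡ (V' ∘ V) ∘ A
  square-∘ {A = A} {A'} {A''} {U} {U'} {V} {V'} p q = begin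
    A'' ∘ (U' ∘ U)   ≡⟨ sym (assoc A'' U' U) ⟩
    (A'' ∘ U') ∘ U   ≡⟨ cong (_∘ U) p ⟩
    (V' ∘ A') ∘ U    ≡⟨ assoc V' A' U ⟩
    V' ∘ (A' ∘ U)    ≡⟨ cong (V' ∘_) q ⟩
    V' ∘ (V ∘ A)     ≡⟨ sym (assoc V' V A) ⟩
    (V' ∘ V) ∘ A     ∎

  square-inv : ∀ {a b a' b'} {A : Hom a a'} {A' : Hom b b'}
    {U : Hom a b} {V : Hom a' b'} →
    A' ∘ U ≡ V ∘ A → A ∘ inv U ≡ inv V ∘ A'
  square-inv {A = A} {A'} {U} {V} p = begin
    A ∘ inv U                      ≡⟨ sym (idl _) ⟩
    id ∘ (A ∘ inv U)               ≡⟨ cong (_∘ (A ∘ inv U)) (sym (invl V)) ⟩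
    (inv V ∘ V) ∘ (A ∘ inv U)      ≡⟨ assoc _ _ _ ⟩
    inv V ∘ (V ∘ (A ∘ inv U))      ≡⟨ cong (inv V ∘_) (sym (assoc _ _ _)) ⟩
    inv V ∘ ((V ∘ A) ∘ inv U)      ≡⟨ cong (λ z → inv V ∘ (z ∘ inv U)) (sym p) ⟩
    inv V ∘ ((A' ∘ U) ∘ inv U)     ≡⟨ cong (inv V ∘_) (assoc _ _ _) ⟩
    inv V ∘ (A' ∘ (U ∘ inv U))     ≡⟨ cong (λ z → inv V ∘ (A' ∘ z)) (invr U) ⟩
    inv V ∘ (A' ∘ id)              ≡⟨ cong (inv V ∘_) (idr A') ⟩
    inv V ∘ A'                     ∎

  square-id : ∀ {a a'} {A : Hom a a'} {U : Hom a a} {V : Hom a' a'} →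
    U ≡ id → V ≡ id → A ∘ U ≡ V ∘ A
  square-id {A = A} refl refl = trans (idr A) (sym (idl A))

open Groupoid

record Functor (C D : Groupoid) : Set where
  field
    F₀   : Obj C → Obj D
    F₁   : ∀ {x y} → Hom C x y → Hom D (F₀ x) (F₀ y)
    F-id : ∀ {x} → F₁ (id C {x}) ≡ id D
    F-∘  : ∀ {x y z} (g : Hom C y z) (f : Hom C x y) →
           F₁ (_∘_ C g f) ≡ _∘_ D (F₁ g) (F₁ f)

open Functor

record NatTrans {C D : Groupoid} (F G : Functor C D) : Set where
  field
    η       : ∀ x → Hom D (F₀ F x) (F₀ G x)
    natural : ∀ {x y} (f : Hom C x y) →
              _∘_ D (η y) (F₁ F f) ≡ _∘_ D (F₁ G f) (η x)

open NatTrans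

idF : ∀ {C} → Functor C C
idF = record { F₀ = λ x → x ; F₁ = λ f → f ; F-id = refl ; F-∘ = λ g f → refl }

infixr 9 _∘F_
_∘F_ : ∀ {C D E} → Functor D E → Functor C D → Functor C E
G ∘F F = record
  { F₀ = λ x → F₀ G (F₀ F x)
  ; F₁ = λ f → F₁ G (F₁ F f)
  ; F-id = trans (cong (F₁ G) (F-id F)) (F-id G)
  ; F-∘ = λ g f → trans (cong (F₁ G) (F-∘ F g f)) (F-∘ G (F₁ F g) (F₁ F f))
  }

F-inv : ∀ {C D} (F : Functor C D) {x y} (f : Hom C x y) →
        F₁ F (inv C f) ≡ inv D (F₁ F f)
F-inv {C} {D} F f = begin
    F₁ F (inv C f)                                   ≡⟨ sym (idr D _) ⟩
    D ∘ F₁ F (inv C f) $ id D                        ≡⟨ cong (D ∘ F₁ F (inv C f) $_) (sym (invr D (F₁ F f))) ⟩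
    D ∘ F₁ F (inv C f) $ (D ∘ F₁ F f $ inv D (F₁ F f)) ≡⟨ sym (assoc D _ _ _) ⟩
    D ∘ (D ∘ F₁ F (inv C f) $ F₁ F f) $ inv D (F₁ F f) ≡⟨ cong (λ z → D ∘ z $ inv D (F₁ F f)) (sym (F-∘ F _ _)) ⟩
    D ∘ F₁ F (C ∘ inv C f $ f) $ inv D (F₁ F f)      ≡⟨ cong (λ z → D ∘ F₁ F z $ inv D (F₁ F f)) (invl C f) ⟩
    D ∘ F₁ F (id C) $ inv D (F₁ F f)                 ≡⟨ cong (λ z → D ∘ z $ inv D (F₁ F f)) (F-id F) ⟩
    D ∘ id D $ inv D (F₁ F f)                        ≡⟨ idl D _ ⟩
    inv D (F₁ F f) ∎
  where
  open ≡-Reasoning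
  _∘_$_ : (G : Groupoid) → ∀ {x y z} → Hom G y z → Hom G x y → Hom G x z
  G ∘ g $ f = _∘_ G g f

_×G_ : Groupoid → Groupoid → Groupoid
A ×G B = record
  { Obj = Obj A × Obj B
  ; Hom = λ p q → Hom A (proj₁ p) (proj₁ q) × Hom B (proj₂ p) (proj₂ q)
  ; id = id A , id B
  ; _∘_ = λ g f → _∘_ A (proj₁ g) (proj₁ f) , _∘_ B (proj₂ g) (proj₂ f)
  ; inv = λ f → inv A (proj₁ f) , inv B (proj₂ f)
  ; idl = λ f → cong₂ _,_ (idl A _) (idl B _)
  ; idr = λ f → cong₂ _,_ (idr A _) (idr B _)
  ; assoc = λ h g f → cong₂ _,_ (assoc A _ _ _) (assoc B _ _ _)
  ; invl = λ f → cong₂ _,_ (invl A _) (invl B _)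
  ; invr = λ f → cong₂ _,_ (invr A _) (invr B _)
  }

⟨_,_⟩F : ∀ {C A B} → Functor C A → Functor C B → Functor C (A ×G B)
⟨ F , G ⟩F = record
  { F₀ = λ x → F₀ F x , F₀ G x
  ; F₁ = λ f → F₁ F f , F₁ G f
  ; F-id = cong₂ _,_ (F-id F) (F-id G)
  ; F-∘ = λ g f → cong₂ _,_ (F-∘ F g f) (F-∘ G g f)
  }

_×F_ : ∀ {C D A B} → Functor C A → Functor D B → Functor (C ×G D) (A ×G B)
F ×F G = record
  { F₀ = λ x → F₀ F (proj₁ x) , F₀ G (proj₂ x)
  ; F₁ = λ f → F₁ F (proj₁ f) , F₁ G (proj₂ f)
  ; F-id = cong₂ _,_ (F-id F) (F-id G)
  ; F-∘ = λ g f → cong₂ _,_ (F-∘ F _ _) (F-∘ G _ _)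
  }

Discrete : Groupoid → Set
Discrete G = ∀ {x y} (f : Hom G x y) →
  Σ[ e ∈ x ≡ y ] subst (Hom G x) e (id G {x}) ≡ f

ι : (B : Groupoid) {a b : Obj B} → a ≡ b → Hom B a b
ι B {a} e = subst (Hom B a) e (id B)

module _ {S B T : Groupoid} (u : Functor S B) (v : Functor T B) where

  record PbObj : Set where
    constructor pbobj
    field
      s : Obj S
      t : Obj T
      e : F₀ u s ≡ F₀ v t

  open PbObj

  -- pairs (f , g) with u f = v g (the equation is stated along the
  -- identifications  u s = v t  of source and target)
  record PbHom (p q : PbObj) : Set where
    constructor pbhom
    field
      f    : Hom S (s p) (s q)
      g    : Hom T (t p) (t q)
      comm : _∘_ B (ι B (e q)) (F₁ u f) ≡ _∘_ B (F₁ v g) (ι B (e p))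

  open PbHom

  private
    uip : ∀ {A : Set} {x y : A} (p q : x ≡ y) → p ≡ q
    uip refl refl = refl

    pbhom-≡ : ∀ {p q} {a b : PbHom p q} → f a ≡ f b → g a ≡ g b → a ≡ b
    pbhom-≡ {a = pbhom f₁ g₁ c₁} {pbhom .f₁ .g₁ c₂} refl refl =
      cong (pbhom f₁ g₁) (uip c₁ c₂)

    module B = GL B

  Pullback : Groupoid
  Pullback = record
    { Obj = PbObj
    ; Hom = PbHom
    ; id = λ {p} → pbhom (id S) (id T) (B.square-id (F-id u) (F-id v))
    ; _∘_ = λ b a → pbhom (_∘_ S (f b) (f a)) (_∘_ T (g b) (g a))
        (trans (cong (_∘_ B _) (F-∘ u _ _))
          (trans (B.square-∘ (comm b) (comm a))
                 (cong (λ z → _∘_ B z _) (sym (F-∘ v _ _)))))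
    ; inv = λ a → pbhom (inv S (f a)) (inv T (g a))
        (trans (cong (_∘_ B _) (F-inv u _))
          (trans (B.square-inv (comm a))
                 (cong (λ z → _∘_ B z _) (sym (F-inv v _)))))
    ; idl = λ a → pbhom-≡ (idl S _) (idl T _)
    ; idr = λ a → pbhom-≡ (idr S _) (idr T _)
    ; assoc = λ c b a → pbhom-≡ (assoc S _ _ _) (assoc T _ _ _)
    ; invl = λ a → pbhom-≡ (invl S _) (invl T _)
    ; invr = λ a → pbhom-≡ (invr S _) (invr T _)
    }

  pb-l : Functor Pullback S
  pb-l = record { F₀ = s ; F₁ = f ; F-id = refl ; F-∘ = λ _ _ → refl }

  pb-r : Functor Pullback T
  pb-r = record { F₀ = t ; F₁ = g ; F-id = refl ; F-∘ = λ _ _ → refl }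

  pb-μ : NatTrans (u ∘F pb-l) (v ∘F pb-r)
  pb-μ = record { η = λ p → ι B (e p) ; natural = comm }

module _ {S B T : Groupoid} (u : Functor S B) (v : Functor T B) where

  record Pseudocone (X : Groupoid) : Set where
    constructor pseudocone
    field
      l' : Functor X S
      r' : Functor X T
      ν  : NatTrans (u ∘F l') (v ∘F r')

  open Pseudocone

  record ConeMor {X : Groupoid} (c d : Pseudocone X) : Set where
    constructor conemor
    field
      α    : NatTrans (l' c) (l' d)
      β    : NatTrans (r' c) (r' d)
      comm : ∀ x → _∘_ B (η (ν d) x) (F₁ u (η α x))
                 ≡ _∘_ B (F₁ v (η β x)) (η (ν c) x)

  open ConeMor

  module _ {P : Groupoid} (l : Functor P S) (r : Functor P T)
           (μ : NatTrans (u ∘F l) (v ∘F r)) where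

    Φ : ∀ {X} → Functor X P → Pseudocone X
    Φ h = pseudocone (l ∘F h) (r ∘F h)
            (record { η = λ x → η μ (F₀ h x)
                    ; natural = λ f → natural μ (F₁ h f) })

    -- (P , l , r , μ) is a bipullback: for every groupoid X the functor
    --   Φ : [X , P] → PseudoCones(X),  h ↦ (lh , rh , μh),  γ ↦ (lγ , rγ)
    -- is an equivalence, i.e. essentially surjective, full and faithful
    -- (equality of natural transformations is componentwise).
    record IsBipullback : Set₁ where
      field
        ess-surj : ∀ (X : Groupoid) (c : Pseudocone X) →
          Σ[ h ∈ Functor X P ] ConeMor (Φ h) c
        full : ∀ (X : Groupoid) (h h' : Functor X P)
          (m : ConeMor (Φ h) (Φ h')) →
          Σ[ γ ∈ NatTrans h h' ]
            ((∀ x → F₁ l (η γ x) ≡ η (α m) x) ×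
             (∀ x → F₁ r (η γ x) ≡ η (β m) x))
        faithful : ∀ (X : Groupoid) (h h' : Functor X P)
          (γ γ' : NatTrans h h') →
          (∀ x → F₁ l (η γ x) ≡ F₁ l (η γ' x)) →
          (∀ x → F₁ r (η γ x) ≡ F₁ r (η γ' x)) →
          ∀ x → η γ x ≡ η γ' x

record Prestrategy (A : Groupoid) : Set₁ where
  constructor prestrategy
  field
    carrier : Groupoid
    ∂       : Functor carrier A

open Prestrategy

PB : ∀ {A} → Prestrategy A → Prestrategy A → Groupoid
PB S T = Pullback (∂ S) (∂ T)

_⊥_ : ∀ {A} → Prestrategy A → Prestrategy A → Set₁
S ⊥ T = IsBipullback (∂ S) (∂ T) (pb-l (∂ S) (∂ T)) (pb-r (∂ S) (∂ T))
          (pb-μ (∂ S) (∂ T))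

PSet : Groupoid → Set₂
PSet A = Prestrategy A → Set₁

_ᗮ : ∀ {A} → PSet A → PSet A
(𝐒 ᗮ) T = ∀ S → 𝐒 S → S ⊥ T

_⊆_ : ∀ {A} → PSet A → PSet A → Set₁
𝐒 ⊆ 𝐓 = ∀ S → 𝐒 S → 𝐓 S

_≐_ : ∀ {A} → PSet A → PSet A → Set₁
𝐒 ≐ 𝐓 = (𝐒 ⊆ 𝐓) × (𝐓 ⊆ 𝐒)

-- Thin orthogonality relative to a uniform structure 𝐔 on A.
-- For 𝐒 ⊆ 𝐔: 𝐒^⊥th taken within 𝐔^⊥.
thinᗮL : ∀ {A} → PSet A → PSet A → PSet A
thinᗮL 𝐔 𝐒 T = (𝐔 ᗮ) T × (∀ S → 𝐒 S → Discrete (PB S T))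

-- For 𝐓 ⊆ 𝐔^⊥: 𝐓^⊥th taken within 𝐔.
thinᗮR : ∀ {A} → PSet A → PSet A → PSet A
thinᗮR 𝐔 𝐓 S = 𝐔 S × (∀ T → 𝐓 T → Discrete (PB S T))

record WideSub (A : Groupoid) : Set₁ where
  field
    P      : ∀ {x y} → Hom A x y → Set
    P-prop : ∀ {x y} {f : Hom A x y} (p q : P f) → p ≡ q
    P-id   : ∀ {x} → P (id A {x})
    P-∘    : ∀ {x y z} {g : Hom A y z} {f : Hom A x y} → P g → P f →
             P (_∘_ A g f)
    P-inv  : ∀ {x y} {f : Hom A x y} → P f → P (inv A f)

module _ {A : Groupoid} (W : WideSub A) where
  open WideSub W

  private
    sub-≡ : ∀ {x y} {a b : Σ (Hom A x y) P} → proj₁ a ≡ proj₁ b → a ≡ b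
    sub-≡ {a = f , p} {.f , q} refl = cong (f ,_) (P-prop p q)

  SubGroupoid : Groupoid
  SubGroupoid = record
    { Obj = Obj A
    ; Hom = λ x y → Σ (Hom A x y) P
    ; id = id A , P-id
    ; _∘_ = λ g f → _∘_ A (proj₁ g) (proj₁ f) , P-∘ (proj₂ g) (proj₂ f)
    ; inv = λ f → inv A (proj₁ f) , P-inv (proj₂ f)
    ; idl = λ f → sub-≡ (idl A _)
    ; idr = λ f → sub-≡ (idr A _)
    ; assoc = λ h g f → sub-≡ (assoc A _ _ _)
    ; invl = λ f → sub-≡ (invl A _)
    ; invr = λ f → sub-≡ (invr A _)
    }

  inclPS : Prestrategy A
  inclPS = prestrategy SubGroupoid
    (record { F₀ = λ x → x ; F₁ = proj₁ ; F-id = refl ; F-∘ = λ _ _ → refl })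

record ThinGroupoid : Set₂ where
  field
    G        : Groupoid
    neg pos  : WideSub G
    U        : PSet G
    U-closed : ((U ᗮ) ᗮ) ≐ U
    T        : PSet G
    T⊆U      : T ⊆ U
    T-closed : thinᗮR U (thinᗮL U T) ≐ T
    neg∈T    : T (inclPS neg)
    pos∈T⊥   : thinᗮL U T (inclPS pos)

module _ (A B : ThinGroupoid) where
  private
    module A = ThinGroupoid A
    module B = ThinGroupoid B

  ⊸G : Groupoid
  ⊸G = A.G ×G B.G

  _⊗_ : Prestrategy A.G → Prestrategy B.G → Prestrategy ⊸G
  S ⊗ V = prestrategy (carrier S ×G carrier V) (∂ S ×F ∂ V)

  ⊸Gen : PSet ⊸G
  ⊸Gen W = Σ[ S ∈ Prestrategy A.G ] Σ[ V ∈ Prestrategy B.G ]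
             (A.U S × (B.U ᗮ) V × W ≡ S ⊗ V)

  ⊸U : PSet ⊸G
  ⊸U = ⊸Gen ᗮ

  ⊸T : PSet ⊸G
  ⊸T W = ⊸U W ×
    (∀ (S : Prestrategy A.G) (V : Prestrategy B.G) →
       A.T S → thinᗮL B.U B.T V → Discrete (PB W (S ⊗ V)))

idSpan : (A : ThinGroupoid) → Prestrategy (ThinGroupoid.G A ×G ThinGroupoid.G A)
idSpan A = prestrategy (ThinGroupoid.G A) ⟨ idF , idF ⟩F

{-# OPTIONS --with-K #-}
module Submission where

-- The pullback of S × V → A × A ← A along the diagonal has, up to the
-- redundant copy of the apex object, the same objects and morphisms as
-- the pullback of S → A ← V: a pair of isomorphisms into a common object
-- of A amounts to one isomorphism between the two boundaries.  Hence
-- discreteness of the latter (thin orthogonality) transfers to the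
-- former, and pseudocones over the diagonal cospan transpose to
-- pseudocones over S → A ← V, so S ⊥ V yields the bipullback property.

open import Defs
open import Axiom.UniquenessOfIdentityProofs.WithK using (uip)
open import Data.Product using (Σ-syntax; _,_; proj₁; proj₂)
open import Function.Definitions using (Injective)
open import Relation.Binary.PropositionalEquality
  using (_≡_; refl; sym; trans; cong; cong₂; subst; module ≡-Reasoning)

open Functor
open NatTrans

module GroupoidProperties (A : Groupoid) where
  open Groupoid A
  open GL A using (square-∘; square-inv)
  open ≡-Reasoning

  inv-id : ∀ {x} → inv (id {x}) ≡ id
  inv-id = trans (sym (idl _)) (invr _)

  ∘-cancelˡ : ∀ {x y z} (k : Hom y z) {f g : Hom x y} → k ∘ f ≡ k ∘ g → f ≡ g
  ∘-cancelˡ k {f} {g} p = begin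
    f                ≡⟨ sym (idl f) ⟩
    id ∘ f           ≡⟨ cong (_∘ f) (sym (invl k)) ⟩
    (inv k ∘ k) ∘ f  ≡⟨ assoc _ _ _ ⟩
    inv k ∘ (k ∘ f)  ≡⟨ cong (inv k ∘_) p ⟩
    inv k ∘ (k ∘ g)  ≡⟨ sym (assoc _ _ _) ⟩
    (inv k ∘ k) ∘ g  ≡⟨ cong (_∘ g) (invl k) ⟩
    id ∘ g           ≡⟨ idl g ⟩
    g                ∎

  inv-∘-transpose : ∀ {x y z} {a : Hom y z} {b : Hom x z} {c : Hom x y} →
                    inv a ∘ b ≡ c → b ≡ a ∘ c
  inv-∘-transpose {a = a} {b} {c} p = begin
    b                ≡⟨ sym (idl b) ⟩
    id ∘ b           ≡⟨ cong (_∘ b) (sym (invr a)) ⟩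
    (a ∘ inv a) ∘ b  ≡⟨ assoc _ _ _ ⟩
    a ∘ (inv a ∘ b)  ≡⟨ cong (a ∘_) p ⟩
    a ∘ c            ∎

  square-∘-inv : ∀ {a b c a' b' c'} {k₁ : Hom a b} {k₁' : Hom a' b'}
    {k₂ : Hom a c} {k₂' : Hom a' c'} {f : Hom a a'} {g : Hom b b'} {h : Hom c c'} →
    k₁' ∘ f ≡ g ∘ k₁ → k₂' ∘ f ≡ h ∘ k₂ → (k₂' ∘ inv k₁') ∘ g ≡ h ∘ (k₂ ∘ inv k₁)
  square-∘-inv sq₁ sq₂ = sym (square-∘ (sym sq₂) (square-inv (sym sq₁)))

  ι-trans-sym : ∀ {a b c} (p : a ≡ b) (q : a ≡ c) →
                ι A (trans (sym p) q) ≡ ι A q ∘ inv (ι A p)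
  ι-trans-sym refl refl = sym (trans (cong (id ∘_) inv-id) (idl id))

proj₁F : ∀ {A B} → Functor (A ×G B) A
proj₁F = record { F₀ = proj₁ ; F₁ = proj₁ ; F-id = refl ; F-∘ = λ _ _ → refl }

proj₂F : ∀ {A B} → Functor (A ×G B) B
proj₂F = record { F₀ = proj₂ ; F₁ = proj₂ ; F-id = refl ; F-∘ = λ _ _ → refl }

ι-× : (A B : Groupoid) {x y : Groupoid.Obj (A ×G B)} (e : x ≡ y) →
      ι (A ×G B) e ≡ (ι A (cong proj₁ e) , ι B (cong proj₂ e))
ι-× A B refl = refl

ι-×-constʳ : (A B : Groupoid) {a a' : Groupoid.Obj A} {b : Groupoid.Obj B}
             (e : a ≡ a') → ι (A ×G B) (cong (_, b) e) ≡ (ι A e , Groupoid.id B)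
ι-×-constʳ A B refl = refl

module PullbackProperties {S B T : Groupoid} (u : Functor S B) (v : Functor T B) where

  pbobj-≡ : ∀ {s s' t t'} {e : F₀ u s ≡ F₀ v t} {e' : F₀ u s' ≡ F₀ v t'} →
            s ≡ s' → t ≡ t' → _≡_ {A = PbObj u v} (pbobj s t e) (pbobj s' t' e')
  pbobj-≡ {e = e} {e'} refl refl = cong (pbobj _ _) (uip e e')

  pbhom-≡ : ∀ {p q} {a b : PbHom u v p q} →
            PbHom.f a ≡ PbHom.f b → PbHom.g a ≡ PbHom.g b → a ≡ b
  pbhom-≡ {a = pbhom f g c} {pbhom .f .g c'} refl refl = cong (pbhom f g) (uip c c')

  Φ-pb : ∀ {X} → Functor X (Pullback u v) → Pseudocone u v X
  Φ-pb = Φ u v (pb-l u v) (pb-r u v) (pb-μ u v)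

  -- Φ is always full and faithful for a strict pullback, since a morphism
  -- of the pullback is exactly a pair of morphisms making the square commute.
  Pullback-isBipullback :
    (∀ X (c : Pseudocone u v X) →
       Σ[ h ∈ Functor X (Pullback u v) ] ConeMor u v (Φ-pb h) c) →
    IsBipullback u v (pb-l u v) (pb-r u v) (pb-μ u v)
  Pullback-isBipullback ess-surj = record
    { ess-surj = ess-surj
    ; full = λ X h h' m →
        record { η = λ x → pbhom (η (ConeMor.α m) x) (η (ConeMor.β m) x) (ConeMor.comm m x)
               ; natural = λ φ → pbhom-≡ (natural (ConeMor.α m) φ) (natural (ConeMor.β m) φ) }
        , (λ _ → refl) , (λ _ → refl)
    ; faithful = λ X h h' γ γ' p q x → pbhom-≡ (p x) (q x)
    }

module _ {S B₁ B₂ T : Groupoid}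
         (u : Functor S (B₁ ×G B₂)) (v : Functor T (B₁ ×G B₂)) where

  pbhom-comm-× : ∀ {p q} (F : PbHom u v p q) →
    Groupoid._∘_ (B₁ ×G B₂)
      (ι B₁ (cong proj₁ (PbObj.e q)) , ι B₂ (cong proj₂ (PbObj.e q)))
      (F₁ u (PbHom.f F))
    ≡ Groupoid._∘_ (B₁ ×G B₂)
      (F₁ v (PbHom.g F))
      (ι B₁ (cong proj₁ (PbObj.e p)) , ι B₂ (cong proj₂ (PbObj.e p)))
  pbhom-comm-× {p} {q} F =
    trans (cong (λ z → Groupoid._∘_ (B₁ ×G B₂) z (F₁ u (PbHom.f F)))
                (sym (ι-× B₁ B₂ (PbObj.e q))))
      (trans (PbHom.comm F)
             (cong (Groupoid._∘_ (B₁ ×G B₂) (F₁ v (PbHom.g F)))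
                   (ι-× B₁ B₂ (PbObj.e p))))

Faithful : ∀ {C D} → Functor C D → Set
Faithful {C} F = ∀ {x y} {f g : Groupoid.Hom C x y} → F₁ F f ≡ F₁ F g → f ≡ g

module _ {C : Groupoid} where
  open Groupoid C

  Discrete-endo≡id : Discrete C → ∀ {x} (f : Hom x x) → f ≡ id
  Discrete-endo≡id d f with d f
  ... | e , p = trans (sym p) (cong (λ e → subst (Hom _) e id) (uip e refl))

  Discrete-intro : (∀ {x y} → Hom x y → x ≡ y) →
                   (∀ {x} (f : Hom x x) → f ≡ id) → Discrete C
  Discrete-intro obj endo f = obj f , from-endo (obj f) f
    where
    from-endo : ∀ {x y} (e : x ≡ y) (f : Hom x y) → subst (Hom x) e id ≡ f
    from-endo refl f = sym (endo f)

Discrete-reflect : ∀ {C D} (F : Functor C D) →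
                   Injective _≡_ _≡_ (F₀ F) → Faithful F → Discrete D → Discrete C
Discrete-reflect {C} {D} F injective faithful d = Discrete-intro {C}
  (λ f → injective (proj₁ (d (F₁ F f))))
  (λ f → faithful (trans (Discrete-endo≡id {D} d (F₁ F f)) (sym (F-id F))))

module DiagonalPullback (A : Groupoid) (S V : Prestrategy A) where
  open Groupoid A
  open GroupoidProperties A
  open GL A using (square-∘; square-inv)
  open ≡-Reasoning
  open Prestrategy S using () renaming (carrier to G; ∂ to ∂S)
  open Prestrategy V using () renaming (carrier to H; ∂ to ∂V)
  private
    module A² = Groupoid (A ×G A)

  Δ : Functor A (A ×G A)
  Δ = ⟨ idF , idF ⟩F

  w : Functor (G ×G H) (A ×G A)
  w = ∂S ×F ∂V

  P : Groupoid
  P = Pullback ∂S ∂V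

  restrict₀ : PbObj Δ w → PbObj ∂S ∂V
  restrict₀ (pbobj a (s , t) e) = pbobj s t (trans (sym (cong proj₁ e)) (cong proj₂ e))

  restrict₁ : ∀ {p q} → PbHom Δ w p q → PbHom ∂S ∂V (restrict₀ p) (restrict₀ q)
  restrict₁ {p} {q} F = pbhom (proj₁ (PbHom.g F)) (proj₂ (PbHom.g F))
    (trans (cong (_∘ _) (ι-trans-sym (cong proj₁ (PbObj.e q)) (cong proj₂ (PbObj.e q))))
      (trans (square-∘-inv (cong proj₁ (pbhom-comm-× Δ w F)) (cong proj₂ (pbhom-comm-× Δ w F)))
             (cong (_ ∘_) (sym (ι-trans-sym (cong proj₁ (PbObj.e p)) (cong proj₂ (PbObj.e p)))))))

  restrict : Functor (Pullback Δ w) P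
  restrict = record
    { F₀ = restrict₀
    ; F₁ = restrict₁
    ; F-id = PullbackProperties.pbhom-≡ ∂S ∂V refl refl
    ; F-∘ = λ _ _ → PullbackProperties.pbhom-≡ ∂S ∂V refl refl
    }

  restrict-injective : Injective _≡_ _≡_ restrict₀
  restrict-injective {pbobj a (s , t) e} {pbobj a' (s' , t') e'} eq
    with cong PbObj.s eq | cong PbObj.t eq
  ... | refl | refl = PullbackProperties.pbobj-≡ Δ w
    (trans (cong proj₁ e) (sym (cong proj₁ e'))) refl

  -- The A-component of a morphism is recovered from its S-component via
  -- the first component of the commuting square.
  restrict-faithful : Faithful restrict
  restrict-faithful {p} {q} {F} {F'} eq =
    PullbackProperties.pbhom-≡ Δ w
      (∘-cancelˡ (ι A (cong proj₁ (PbObj.e q)))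
        (trans (cong proj₁ (pbhom-comm-× Δ w F))
          (trans (cong (λ g → F₁ ∂S g ∘ ι A (cong proj₁ (PbObj.e p))) g₁≡)
                 (sym (cong proj₁ (pbhom-comm-× Δ w F'))))))
      (cong₂ _,_ g₁≡ (cong PbHom.g eq))
    where
    g₁≡ : proj₁ (PbHom.g F) ≡ proj₁ (PbHom.g F')
    g₁≡ = cong PbHom.f eq

  discrete : Discrete P → Discrete (Pullback Δ w)
  discrete = Discrete-reflect restrict restrict-injective restrict-faithful

  extend₀ : PbObj ∂S ∂V → PbObj w Δ
  extend₀ (pbobj s t e) = pbobj (s , t) (F₀ ∂V t) (cong (_, F₀ ∂V t) e)

  extend₁ : ∀ {p q} → PbHom ∂S ∂V p q → PbHom w Δ (extend₀ p) (extend₀ q)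
  extend₁ {p} {q} (pbhom f g c) = pbhom (f , g) (F₁ ∂V g)
    (trans (cong (A²._∘ (F₁ ∂S f , F₁ ∂V g)) (ι-×-constʳ A A (PbObj.e q)))
      (trans (cong₂ _,_ c (trans (idl _) (sym (idr _))))
             (cong ((F₁ ∂V g , F₁ ∂V g) A².∘_) (sym (ι-×-constʳ A A (PbObj.e p))))))

  extend : Functor P (Pullback w Δ)
  extend = record
    { F₀ = extend₀
    ; F₁ = extend₁
    ; F-id = PullbackProperties.pbhom-≡ w Δ refl (F-id ∂V)
    ; F-∘ = λ _ _ → PullbackProperties.pbhom-≡ w Δ refl (F-∘ ∂V _ _)
    }

  -- A pseudocone over w and Δ consists of isomorphisms ν₁ x, ν₂ x from the
  -- two boundaries into a common object; ν₂⁻¹ ν₁ relates the boundaries.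
  transpose : ∀ {X} → Pseudocone w Δ X → Pseudocone ∂S ∂V X
  transpose (pseudocone l' r' ν) = pseudocone (proj₁F ∘F l') (proj₂F ∘F l') (record
    { η = λ x → inv (proj₂ (η ν x)) ∘ proj₁ (η ν x)
    ; natural = λ φ → sym (square-∘
        (square-inv (sym (cong proj₂ (natural ν φ))))
        (sym (cong proj₁ (natural ν φ))))
    })

  module Lift (S⊥V : S ⊥ V) {X : Groupoid} (c : Pseudocone w Δ X) where
    open Pseudocone c
    open IsBipullback S⊥V using (ess-surj)

    ν₁ : ∀ x → Hom (F₀ ∂S (proj₁ (F₀ l' x))) (F₀ r' x)
    ν₂ : ∀ x → Hom (F₀ ∂V (proj₂ (F₀ l' x))) (F₀ r' x)
    ν₁ x = proj₁ (η ν x)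
    ν₂ x = proj₂ (η ν x)

    h : Functor X P
    h = proj₁ (ess-surj X (transpose c))

    m : ConeMor ∂S ∂V (PullbackProperties.Φ-pb ∂S ∂V h) (transpose c)
    m = proj₂ (ess-surj X (transpose c))

    α : NatTrans (pb-l ∂S ∂V ∘F h) (proj₁F ∘F l')
    α = ConeMor.α m

    β : NatTrans (pb-r ∂S ∂V ∘F h) (proj₂F ∘F l')
    β = ConeMor.β m

    α' : NatTrans (pb-l w Δ ∘F extend ∘F h) l'
    α' = record
      { η = λ x → η α x , η β x
      ; natural = λ φ → cong₂ _,_ (natural α φ) (natural β φ) }

    ∂V-natural-β : ∀ {x y} (φ : Groupoid.Hom X x y) →
      F₁ ∂V (F₁ (proj₂F ∘F l') φ) ∘ F₁ ∂V (η β x)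
        ≡ F₁ ∂V (η β y) ∘ F₁ ∂V (PbHom.g (F₁ h φ))
    ∂V-natural-β φ = trans (sym (F-∘ ∂V _ _))
      (trans (cong (F₁ ∂V) (sym (natural β φ))) (F-∘ ∂V _ _))

    β' : NatTrans (pb-r w Δ ∘F extend ∘F h) r'
    β' = record
      { η = λ x → ν₂ x ∘ F₁ ∂V (η β x)
      ; natural = λ φ → sym (square-∘ (sym (cong proj₂ (natural ν φ))) (∂V-natural-β φ)) }

    comm₁ : ∀ x → ν₁ x ∘ F₁ ∂S (η α x)
                ≡ (ν₂ x ∘ F₁ ∂V (η β x)) ∘ ι A (PbObj.e (F₀ h x))
    comm₁ x = begin
      ν₁ x ∘ F₁ ∂S (η α x)
        ≡⟨ inv-∘-transpose (trans (sym (assoc _ _ _)) (ConeMor.comm m x)) ⟩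
      ν₂ x ∘ (F₁ ∂V (η β x) ∘ ι A (PbObj.e (F₀ h x)))
        ≡⟨ sym (assoc _ _ _) ⟩
      (ν₂ x ∘ F₁ ∂V (η β x)) ∘ ι A (PbObj.e (F₀ h x)) ∎

    lift : Σ[ k ∈ Functor X (Pullback w Δ) ] ConeMor w Δ (PullbackProperties.Φ-pb w Δ k) c
    lift = extend ∘F h , conemor α' β' (λ x →
      trans (cong₂ _,_ (comm₁ x) (sym (idr _)))
            (cong ((η β' x , η β' x) A².∘_) (sym (ι-×-constʳ A A (PbObj.e (F₀ h x))))))

  isBipullback : S ⊥ V → IsBipullback w Δ (pb-l w Δ) (pb-r w Δ) (pb-μ w Δ)
  isBipullback S⊥V = PullbackProperties.Pullback-isBipullback w Δ
    (λ X → Lift.lift S⊥V)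

lemma8 : (A : ThinGroupoid) → ⊸T A A (idSpan A)
lemma8 A = uniform , thin
  where
  open ThinGroupoid A using (G; U; T)

  uniform : ⊸U A A (idSpan A)
  uniform _ (S , V , S∈U , V∈U⊥ , refl) =
    DiagonalPullback.isBipullback G S V (V∈U⊥ S S∈U)

  thin : ∀ S V → T S → thinᗮL U T V → Discrete (PB (idSpan A) (_⊗_ A A S V))
  thin S V S∈T (_ , V⊥thT) = DiagonalPullback.discrete G S V (V⊥thT S S∈T)
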